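{- Let $t$ be an arbor on a finite set $I$ with $|I|=d$. Then the polytope $Q_t$ is, up to unimodular equivalence, a $Y$-generalized permutohedron: there is a $Y$-generalized permutohedron $Q'\subset\mathbb{R}^{d+1}$, contained in an affine hyperplane $\{z:\sum_j z_j=c\}$ with $c$ an integer, and an invertible affine map from this hyperplane to $\mathbb{R}^d\cong\mathbb{R}^I$ sending $\mathbb{Z}^{d+1}\cap\{\sum_j z_j=c\}$ bijectively onto $\mathbb{Z}^d$ and $Q'$ onto $Q_t$.
   Context: An arbor on a finite non-empty set $I$ is a rooted tree whose vertices are labeled by pairwise disjoint non-empty subsets of $I$ whose union is $I$; we identify a vertex with its label set. For a vertex $v$, $\mathscr{D}(v)$ is the union of the labels of all vertices whose path to the root passes through $v$ (including $v$). The polytope $Q_t\subset \mathbb{R}^I$ is defined by $x_i\ge 0$ for all $i\in I$ and $\sum_{i\in\mathscr{D}(v)}x_i\le|\mathscr{D}(v)|$ for every vertex $v$. With $e_0,\dots,e_d$ the standard basis of $\mathbb{Z}^{d+1}$, a scaled standard simplex is the convex hull of $\{k_ie_i\}_{i\in J}$ for a non-empty $J\subseteq\{0,\dots,d\}$ and positive integers $k_i$; a $Y$-generalized permutohedron (in the sense of Postnikov) is a Minkowski sum of scaled standard simplices.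
   Formalization: The polytopes $Q_t$ and $Q'$ are replaced by their rational points in ℚ^d and ℚ^(d+1) rather than ℝ^d and ℝ^(d+1), and the affine map has rational coefficients. -}

module Defs where

open import Data.Nat using (ℕ; zero; suc)
open import Data.Integer using (ℤ; +_)
open import Data.Rational using (ℚ; _/_; 0ℚ; 1ℚ; _+_; _*_; _≤_)
open import Data.Fin using (Fin; zero; suc; _≟_)
open import Relation.Nullary using (yes; no)
open import Data.List using (List; []; _∷_; _++_; map; foldr; length; zipWith; allFin; concatMap)
open import Data.List.Relation.Unary.All using (All)
open import Data.List.Relation.Unary.Any using (Any)
open import Data.List.Relation.Unary.Unique.Propositional using (Unique)
open import Data.List.Relation.Binary.Permutation.Propositional using (_↭_)
open import Data.List.Membership.Propositional using (_∈_)
open import Data.Product using (Σ; ∃; _×_; _,_; proj₁; proj₂)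
open import Relation.Binary.PropositionalEquality using (_≡_; _≢_)

Pt : ℕ → Set
Pt n = Fin n → ℚ

ℤ→ℚ : ℤ → ℚ
ℤ→ℚ z = z / 1

ℕ→ℚ : ℕ → ℚ
ℕ→ℚ k = (+ k) / 1

IsInt : ℚ → Set
IsInt q = ∃ λ (z : ℤ) → q ≡ ℤ→ℚ z

IsLattice : ∀ {n} → Pt n → Set
IsLattice p = ∀ i → IsInt (p i)

sumℚ : List ℚ → ℚ
sumℚ = foldr _+_ 0ℚ

sumFin : (n : ℕ) → (Fin n → ℚ) → ℚ
sumFin zero    f = 0ℚ
sumFin (suc n) f = f zero + sumFin n (λ i → f (suc i))

-- Arbors on I = Fin d.  A vertex is a node carrying its label (a list of
-- elements of I) and the list of its children.

data Tree (d : ℕ) : Set where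
  node : List (Fin d) → List (Tree d) → Tree d

mutual
  𝒟 : ∀ {d} → Tree d → List (Fin d)
  𝒟 (node l cs) = l ++ 𝒟s cs

  𝒟s : ∀ {d} → List (Tree d) → List (Fin d)
  𝒟s []       = []
  𝒟s (c ∷ cs) = 𝒟 c ++ 𝒟s cs

-- all vertices (identified with the subtrees they root)
mutual
  vertices : ∀ {d} → Tree d → List (Tree d)
  vertices (node l cs) = node l cs ∷ verticesₛ cs

  verticesₛ : ∀ {d} → List (Tree d) → List (Tree d)
  verticesₛ []       = []
  verticesₛ (c ∷ cs) = vertices c ++ verticesₛ cs

label : ∀ {d} → Tree d → List (Fin d)
label (node l _) = l

-- An arbor on Fin d: every label is non-empty, and the labels are pairwise
-- disjoint (and duplicate-free) with union Fin d; i.e. the concatenation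
-- of all labels is a permutation of the list of all elements of Fin d.
IsArbor : ∀ {d} → Tree d → Set
IsArbor {d} t = All (λ v → label v ≢ []) (vertices t) × (𝒟 t ↭ allFin d)

-- Q_t (its rational points)
InQ : ∀ {d} → Tree d → Pt d → Set
InQ t x = (∀ i → 0ℚ ≤ x i)
        × All (λ v → sumℚ (map x (𝒟 v)) ≤ ℕ→ℚ (length (𝒟 v))) (vertices t)

InConv : ∀ {n} → List (Pt n) → Pt n → Set
InConv ps p = ∃ λ (ws : List ℚ) →
    length ws ≡ length ps
  × All (λ w → 0ℚ ≤ w) ws
  × sumℚ ws ≡ 1ℚ
  × (∀ i → p i ≡ sumℚ (zipWith (λ w v → w * v i) ws ps))

scaledBasis : ∀ {n} → Fin n → ℕ → Pt n
scaledBasis j k i with j ≟ i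
... | yes _ = ℕ→ℚ k
... | no  _ = 0ℚ

-- data of a scaled standard simplex: a list of pairs (j , k_j)
SimplexData : ℕ → Set
SimplexData n = List (Fin n × ℕ)

ValidSimplex : ∀ {n} → SimplexData n → Set
ValidSimplex s = (s ≢ []) × Unique (map proj₁ s) × All (λ jk → proj₂ jk ≢ 0) s

InSimplex : ∀ {n} → SimplexData n → Pt n → Set
InSimplex s = InConv (map (λ jk → scaledBasis (proj₁ jk) (proj₂ jk)) s)

InMinkSum : ∀ {n} → List (Pt n → Set) → Pt n → Set
InMinkSum []       p = ∀ i → p i ≡ 0ℚ
InMinkSum (S ∷ Ss) p = ∃ λ q → ∃ λ r → S q × InMinkSum Ss r × (∀ i → p i ≡ q i + r i)

InYGP : ∀ {n} → List (SimplexData n) → Pt n → Set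
InYGP ss = InMinkSum (map InSimplex ss)

ValidYGP : ∀ {n} → List (SimplexData n) → Set
ValidYGP ss = (ss ≢ []) × All ValidSimplex ss

record Affine (m n : ℕ) : Set where
  constructor affine
  field
    A : Fin n → Fin m → ℚ
    b : Fin n → ℚ

apply : ∀ {m n} → Affine m n → Pt m → Pt n
apply (affine A b) z i = sumFin _ (λ j → A i j * z j) + b i

InHyp : ∀ {m} → ℤ → Pt m → Set
InHyp {m} c z = sumFin m z ≡ ℤ→ℚ c

_≗ₚ_ : ∀ {n} → Pt n → Pt n → Set
p ≗ₚ q = ∀ i → p i ≡ q i

IsUnimodularOn : ∀ {m n} → ℤ → Affine m n → Set
IsUnimodularOn {m} {n} c f =
    (∀ z z' → InHyp c z → InHyp c z' → apply f z ≗ₚ apply f z' → z ≗ₚ z')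
  × (∀ (y : Pt n) → ∃ λ z → InHyp c z × apply f z ≗ₚ y)
  × (∀ z → InHyp c z → IsLattice z → IsLattice (apply f z))
  × (∀ (y : Pt n) → IsLattice y → ∃ λ z → InHyp c z × IsLattice z × apply f z ≗ₚ y)

-- Coordinate 0 of ℚ^(d+1) is a slack coordinate and i ∈ I becomes coordinate i + 1. Each vertex v of t
-- contributes the simplex |label v| · Δ on 0 together with the labels of v and of its ancestors; the
-- Minkowski sum Q′ of these simplices lies on Σ z = d, and forgetting coordinate 0 is a unimodular
-- bijection of that hyperplane onto ℚ^d. It maps Q′ onto Q_t because, by induction on the tree, the
-- sum of the simplices of a subtree t below the coordinates B consists exactly of the z ≥ 0 supported
-- on B ∪ 𝒟(t) with Σ_{B ∪ 𝒟(t)} z = |𝒟(t)| and Σ_{𝒟(v)} z ≤ |𝒟(v)| for the vertices v of t. Adding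
-- masses gives one inclusion; for the other, the mass on B is shared between the two summands in
-- proportion to the slack that the constraints leave them.

module Submission where

open import Defs
open import Data.Nat using (ℕ)
open import Data.Integer using (ℤ)
open import Data.List using (List)
open import Data.Product using (∃; _×_)

open import Data.Nat using (zero; suc)
import Data.Nat.Properties as ℕP
open import Data.Integer as ℤ using ()
import Data.Integer.Properties as ℤP
open import Data.Rational using (ℚ; 0ℚ; 1ℚ; _+_; _*_; _-_; -_; _≤_; _<_; 1/_)
import Data.Rational as Q
import Data.Rational.Properties as QP
import Data.Rational.Unnormalised as U
import Data.Rational.Unnormalised.Properties as UP
open import Data.Rational.Solver using (module +-*-Solver)
open import Data.Fin as Fin using (Fin; zero; suc)
open import Data.List using ([]; _∷_; _++_; map; length; zipWith; tabulate; allFin)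
open import Data.List.Properties
  using (length-++; length-map; length-tabulate; ++-assoc; ++-identityʳ; ++-conicalʳ; map-++; map-∘; map-id; map-tabulate)
open import Data.List.Relation.Unary.All using (All; []; _∷_)
import Data.List.Relation.Unary.All as All
import Data.List.Relation.Unary.All.Properties as AllP
open import Data.List.Relation.Unary.AllPairs using ([]; _∷_)
open import Data.List.Relation.Unary.Any using (here; there)
open import Data.List.Relation.Unary.Unique.Propositional using (Unique)
import Data.List.Relation.Unary.Unique.Propositional.Properties as UniqueP
open import Data.List.Relation.Binary.Permutation.Propositional
  using (_↭_; ↭⇒↭ₛ; ↭-sym; ↭-prep; ↭-trans; ↭-reflexive)
import Data.List.Relation.Binary.Permutation.Propositional.Properties as ↭P
import Data.List.Relation.Binary.Permutation.Setoid.Properties as ↭ₛ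
open import Data.List.Relation.Binary.Subset.Propositional using (_⊆_)
open import Data.List.Relation.Binary.Subset.Propositional.Properties using (++⁺ʳ; xs⊆xs++ys; xs⊆ys++xs)
open import Data.List.Membership.Propositional using (_∈_; _∉_)
open import Data.List.Membership.Propositional.Properties using (∈-++⁺ˡ; ∈-++⁺ʳ; ∈-++⁻; ∈-allFin)
import Data.List.Membership.DecPropositional as DecMembership
open import Data.Product using (Σ; _,_; proj₁; proj₂)
open import Data.Sum using (inj₁; inj₂)
open import Data.Empty using (⊥-elim)
open import Relation.Nullary using (Dec; yes; no; contradiction)
open import Relation.Binary.PropositionalEquality
open import Relation.Binary.Definitions using (tri<; tri≈; tri>)
open +-*-Solver

ℤ→ℚ≃mkℚᵘ : ∀ a → Q.toℚᵘ (ℤ→ℚ a) U.≃ U.mkℚᵘ a 0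
ℤ→ℚ≃mkℚᵘ a = QP.toℚᵘ-fromℚᵘ (U.mkℚᵘ a 0)

ℤ→ℚ-+ : ∀ a b → ℤ→ℚ (a ℤ.+ b) ≡ ℤ→ℚ a + ℤ→ℚ b
ℤ→ℚ-+ a b = QP.toℚᵘ-injective (begin
  Q.toℚᵘ (ℤ→ℚ (a ℤ.+ b))                  ≈⟨ ℤ→ℚ≃mkℚᵘ (a ℤ.+ b) ⟩
  U.mkℚᵘ (a ℤ.+ b) 0                        ≈⟨ U.*≡* (cong₂ ℤ._*_ (sym (cong₂ ℤ._+_ (ℤP.*-identityʳ a) (ℤP.*-identityʳ b))) refl) ⟩
  U.mkℚᵘ a 0 U.+ U.mkℚᵘ b 0                 ≈⟨ UP.+-cong (UP.≃-sym (ℤ→ℚ≃mkℚᵘ a)) (UP.≃-sym (ℤ→ℚ≃mkℚᵘ b)) ⟩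
  Q.toℚᵘ (ℤ→ℚ a) U.+ Q.toℚᵘ (ℤ→ℚ b)       ≈⟨ UP.≃-sym (QP.toℚᵘ-homo-+ (ℤ→ℚ a) (ℤ→ℚ b)) ⟩
  Q.toℚᵘ (ℤ→ℚ a + ℤ→ℚ b)                  ∎)
  where open UP.≃-Reasoning

ℤ→ℚ-neg : ∀ a → ℤ→ℚ (ℤ.- a) ≡ - ℤ→ℚ a
ℤ→ℚ-neg a = QP.toℚᵘ-injective (begin
  Q.toℚᵘ (ℤ→ℚ (ℤ.- a))   ≈⟨ ℤ→ℚ≃mkℚᵘ (ℤ.- a) ⟩
  U.- U.mkℚᵘ a 0          ≈⟨ UP.-‿cong (UP.≃-sym (ℤ→ℚ≃mkℚᵘ a)) ⟩
  U.- Q.toℚᵘ (ℤ→ℚ a)     ≈⟨ UP.≃-sym (QP.toℚᵘ-homo‿- (ℤ→ℚ a)) ⟩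
  Q.toℚᵘ (- ℤ→ℚ a)       ∎)
  where open UP.≃-Reasoning

ℕ→ℚ-length-++ : ∀ {A : Set} (xs ys : List A) →
  ℕ→ℚ (length (xs ++ ys)) ≡ ℕ→ℚ (length xs) + ℕ→ℚ (length ys)
ℕ→ℚ-length-++ xs ys = trans (cong ℕ→ℚ (length-++ xs)) (ℤ→ℚ-+ (ℤ.+ length xs) (ℤ.+ length ys))

IsInt-- : ∀ {p q} → IsInt p → IsInt q → IsInt (p - q)
IsInt-- (a , refl) (b , refl) = a ℤ.- b , sym (trans (ℤ→ℚ-+ a (ℤ.- b)) (cong (ℤ→ℚ a +_) (ℤ→ℚ-neg b)))

IsInt-+ : ∀ {p q} → IsInt p → IsInt q → IsInt (p + q)
IsInt-+ (a , refl) (b , refl) = a ℤ.+ b , sym (ℤ→ℚ-+ a b)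

0≤ℕ→ℚ : ∀ k → 0ℚ ≤ ℕ→ℚ k
0≤ℕ→ℚ k = QP.nonNegative⁻¹ _ {{QP.normalize-nonNeg k 1}}

0<ℕ→ℚ-suc : ∀ k → 0ℚ < ℕ→ℚ (suc k)
0<ℕ→ℚ-suc k = QP.positive⁻¹ _ {{QP.normalize-pos (suc k) 1}}

0≤+ : ∀ {p q} → 0ℚ ≤ p → 0ℚ ≤ q → 0ℚ ≤ p + q
0≤+ {p} {q} 0≤p 0≤q = subst (_≤ p + q) (QP.+-identityˡ 0ℚ) (QP.+-mono-≤ 0≤p 0≤q)

0≤* : ∀ {p q} → 0ℚ ≤ p → 0ℚ ≤ q → 0ℚ ≤ p * q
0≤* {p} {q} 0≤p 0≤q =
  QP.nonNegative⁻¹ _ {{QP.nonNeg*nonNeg⇒nonNeg p {{Q.nonNegative 0≤p}} q {{Q.nonNegative 0≤q}}}}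

p≤q⇒0≤q-p : ∀ {p q} → p ≤ q → 0ℚ ≤ q - p
p≤q⇒0≤q-p {p} {q} p≤q = subst (_≤ q - p) (QP.+-inverseʳ p) (QP.+-monoˡ-≤ (- p) p≤q)

q≤p+q : ∀ {p q} → 0ℚ ≤ p → q ≤ p + q
q≤p+q {p} {q} 0≤p = subst (_≤ p + q) (QP.+-identityˡ q) (QP.+-monoˡ-≤ q 0≤p)

p+q≡0⇒p≡0 : ∀ {p q} → 0ℚ ≤ p → 0ℚ ≤ q → p + q ≡ 0ℚ → p ≡ 0ℚ
p+q≡0⇒p≡0 {p} {q} 0≤p 0≤q p+q≡0 =
  QP.≤-antisym (subst (p ≤_) p+q≡0 (subst (_≤ p + q) (QP.+-identityʳ p) (QP.+-monoʳ-≤ p 0≤q))) 0≤p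

splitRatio : ∀ {p q} → 0ℚ ≤ p → 0ℚ ≤ q → Σ ℚ λ θ → 0ℚ ≤ θ × θ ≤ 1ℚ × θ * (p + q) ≡ p
splitRatio {p} {q} 0≤p 0≤q with QP.<-cmp 0ℚ (p + q)
... | tri≈ _ 0≡p+q _ =
  0ℚ , QP.≤-refl , QP.nonNegative⁻¹ 1ℚ ,
  trans (QP.*-zeroˡ (p + q)) (sym (p+q≡0⇒p≡0 0≤p 0≤q (sym 0≡p+q)))
... | tri> _ _ p+q<0 = ⊥-elim (QP.<-irrefl refl (QP.<-≤-trans p+q<0 (0≤+ 0≤p 0≤q)))
... | tri< 0<p+q _ _ = θ , 0≤* 0≤p 0≤1/s , θ≤1 , θs≡p
  where
  instance
    s>0 : Q.Positive (p + q)
    s>0 = Q.positive 0<p+q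
    s≢0 : Q.NonZero (p + q)
    s≢0 = QP.pos⇒nonZero (p + q)
  θ = p * 1/ (p + q)
  0≤1/s : 0ℚ ≤ 1/ (p + q)
  0≤1/s = QP.<⇒≤ (QP.positive⁻¹ _ {{QP.1/pos⇒pos (p + q)}})
  θ≤1 : θ ≤ 1ℚ
  θ≤1 = subst (θ ≤_) (QP.*-inverseʳ (p + q))
          (QP.*-monoʳ-≤-nonNeg (1/ (p + q)) {{Q.nonNegative 0≤1/s}} (subst (p ≤_) (QP.+-comm q p) (q≤p+q 0≤q)))
  θs≡p : θ * (p + q) ≡ p
  θs≡p = trans (QP.*-assoc p _ _) (trans (cong (p *_) (QP.*-inverseˡ (p + q))) (QP.*-identityʳ p))

module _ {A : Set} where

  sumOn : List A → (A → ℚ) → ℚ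
  sumOn X z = sumℚ (map z X)

  sumOn-++ : ∀ X Y (z : A → ℚ) → sumOn (X ++ Y) z ≡ sumOn X z + sumOn Y z
  sumOn-++ []      Y z = sym (QP.+-identityˡ _)
  sumOn-++ (x ∷ X) Y z = trans (cong (z x +_) (sumOn-++ X Y z)) (sym (QP.+-assoc (z x) _ _))

  sumOn-cong : ∀ X {z w : A → ℚ} → (∀ {i} → i ∈ X → z i ≡ w i) → sumOn X z ≡ sumOn X w
  sumOn-cong []      z≡w = refl
  sumOn-cong (x ∷ X) z≡w = cong₂ _+_ (z≡w (here refl)) (sumOn-cong X (λ i∈X → z≡w (there i∈X)))

  sumOn-zero : ∀ X {z : A → ℚ} → (∀ {i} → i ∈ X → z i ≡ 0ℚ) → sumOn X z ≡ 0ℚ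
  sumOn-zero []      z≡0 = refl
  sumOn-zero (x ∷ X) z≡0 = cong₂ _+_ (z≡0 (here refl)) (sumOn-zero X (λ i∈X → z≡0 (there i∈X)))

  sumOn-+ : ∀ X (z w : A → ℚ) → sumOn X (λ i → z i + w i) ≡ sumOn X z + sumOn X w
  sumOn-+ []      z w = refl
  sumOn-+ (x ∷ X) z w = trans (cong ((z x + w x) +_) (sumOn-+ X z w))
    (solve 4 (λ a b c d → (a :+ b) :+ (c :+ d) := (a :+ c) :+ (b :+ d)) refl (z x) (w x) (sumOn X z) (sumOn X w))

  sumOn-* : ∀ X c (z : A → ℚ) → sumOn X (λ i → c * z i) ≡ c * sumOn X z
  sumOn-* []      c z = sym (QP.*-zeroʳ c)
  sumOn-* (x ∷ X) c z = trans (cong (c * z x +_) (sumOn-* X c z)) (sym (QP.*-distribˡ-+ c (z x) _))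

  0≤sumOn : ∀ X {z : A → ℚ} → (∀ i → 0ℚ ≤ z i) → 0ℚ ≤ sumOn X z
  0≤sumOn []      0≤z = QP.≤-refl
  0≤sumOn (x ∷ X) 0≤z = 0≤+ (0≤z x) (0≤sumOn X 0≤z)

  sumOn≡0⇒≡0 : ∀ X {z : A → ℚ} → (∀ i → 0ℚ ≤ z i) → sumOn X z ≡ 0ℚ → ∀ {i} → i ∈ X → z i ≡ 0ℚ
  sumOn≡0⇒≡0 (x ∷ X) 0≤z s≡0 (here refl) = p+q≡0⇒p≡0 (0≤z x) (0≤sumOn X 0≤z) s≡0
  sumOn≡0⇒≡0 (x ∷ X) {z} 0≤z s≡0 (there i∈X) =
    sumOn≡0⇒≡0 X 0≤z (p+q≡0⇒p≡0 (0≤sumOn X 0≤z) (0≤z x) (trans (QP.+-comm (sumOn X z) (z x)) s≡0)) i∈X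

  sumOn-single : ∀ X {z : A → ℚ} {i} → Unique X → i ∈ X → (∀ j → j ≢ i → z j ≡ 0ℚ) → sumOn X z ≡ z i
  sumOn-single (x ∷ X) {z} (x∉X ∷ _) (here refl) z≡0 =
    trans (cong (z x +_) (sumOn-zero X (λ {j} j∈X → z≡0 j (λ { refl → All.lookup x∉X j∈X refl }))))
          (QP.+-identityʳ (z x))
  sumOn-single (x ∷ X) {z} (x∉X ∷ X!) (there i∈X) z≡0 =
    trans (cong₂ _+_ (z≡0 x (λ { refl → All.lookup x∉X i∈X refl })) (sumOn-single X X! i∈X z≡0))
          (QP.+-identityˡ _)

  sumOn-↭ : ∀ {X Y} (z : A → ℚ) → X ↭ Y → sumOn X z ≡ sumOn Y z
  sumOn-↭ z X↭Y = ↭ₛ.foldr-commMonoid (setoid ℚ) QP.+-0-isCommutativeMonoid (↭⇒↭ₛ (↭P.map⁺ z X↭Y))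

sumOn-tabulate : ∀ n {A : Set} (g : Fin n → A) (z : A → ℚ) → sumOn (tabulate g) z ≡ sumFin n (λ i → z (g i))
sumOn-tabulate zero    g z = refl
sumOn-tabulate (suc n) g z = cong (z (g zero) +_) (sumOn-tabulate n (λ i → g (suc i)) z)

sumOn-map : ∀ {A B : Set} (X : List A) (g : A → B) (z : B → ℚ) → sumOn (map g X) z ≡ sumOn X (λ i → z (g i))
sumOn-map []      g z = refl
sumOn-map (x ∷ X) g z = cong (z (g x) +_) (sumOn-map X g z)

sumFin-cong : ∀ n {z w : Fin n → ℚ} → (∀ i → z i ≡ w i) → sumFin n z ≡ sumFin n w
sumFin-cong zero    z≡w = refl
sumFin-cong (suc n) z≡w = cong₂ _+_ (z≡w zero) (sumFin-cong n (λ i → z≡w (suc i)))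

module _ {n : ℕ} {Y : List (Fin n)} (Y↭allFin : Y ↭ allFin n) where

  sumOn-↭-allFin : ∀ z → sumOn Y z ≡ sumFin n z
  sumOn-↭-allFin z = trans (sumOn-↭ z Y↭allFin) (sumOn-tabulate n (λ i → i) z)

  length-↭-allFin : length Y ≡ n
  length-↭-allFin = trans (↭P.↭-length Y↭allFin) (length-tabulate (λ i → i))

  ∈-↭-allFin : ∀ i → i ∈ Y
  ∈-↭-allFin i = ↭P.∈-resp-↭ (↭-sym Y↭allFin) (∈-allFin i)

  Unique-↭-allFin : Unique Y
  Unique-↭-allFin = ↭ₛ.Unique-resp-↭ (setoid (Fin n)) (↭⇒↭ₛ (↭-sym Y↭allFin)) (UniqueP.allFin⁺ n)

module _ {A : Set} where

  Unique-++⁻ˡ : ∀ X {Y : List A} → Unique (X ++ Y) → Unique X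
  Unique-++⁻ˡ []      _            = []
  Unique-++⁻ˡ (x ∷ X) (x∉ ∷ X++Y!) = AllP.++⁻ˡ X x∉ ∷ Unique-++⁻ˡ X X++Y!

  Unique-++⁻ʳ : ∀ X {Y : List A} → Unique (X ++ Y) → Unique Y
  Unique-++⁻ʳ []      Y!           = Y!
  Unique-++⁻ʳ (x ∷ X) (_ ∷ X++Y!) = Unique-++⁻ʳ X X++Y!

  Unique-++⇒disjoint : ∀ X {Y : List A} → Unique (X ++ Y) → ∀ {i} → i ∈ X → i ∉ Y
  Unique-++⇒disjoint (x ∷ X) (x∉ ∷ _) (here refl) i∈Y = All.lookup x∉ (∈-++⁺ʳ X i∈Y) refl
  Unique-++⇒disjoint (x ∷ X) (_ ∷ X++Y!) (there i∈X) = Unique-++⇒disjoint X X++Y! i∈X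

  Unique-++-branches : ∀ B X Y → Unique (B ++ (X ++ Y)) → Unique (B ++ X) × Unique (B ++ Y)
  Unique-++-branches B X Y u =
    Unique-++⁻ˡ (B ++ X) (subst Unique (sym (++-assoc B X Y)) u) ,
    UniqueP.++⁺ (Unique-++⁻ˡ B u) (Unique-++⁻ʳ X (Unique-++⁻ʳ B u))
                (λ (i∈B , i∈Y) → Unique-++⇒disjoint B u i∈B (∈-++⁺ʳ X i∈Y))

map-≢[] : ∀ {A B : Set} {f : A → B} (xs : List A) → xs ≢ [] → map f xs ≢ []
map-≢[] []      xs≢[] = ⊥-elim (xs≢[] refl)
map-≢[] (x ∷ xs) _    ()

length≢0 : ∀ {A : Set} (xs : List A) → xs ≢ [] → length xs ≢ 0
length≢0 []      xs≢[] _ = xs≢[] refl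
length≢0 (x ∷ xs) _    ()

module _ {n : ℕ} where

  open DecMembership (Fin._≟_ {n}) using (_∈?_)

  Supported : List (Fin n) → Pt n → Set
  Supported X z = ∀ i → i ∉ X → z i ≡ 0ℚ

  NonNeg : Pt n → Set
  NonNeg z = ∀ i → 0ℚ ≤ z i

  record InΔ (X : List (Fin n)) (m : ℚ) (z : Pt n) : Set where
    constructor inΔ
    field
      supported : Supported X z
      nonNeg    : NonNeg z
      mass      : sumOn X z ≡ m

  open InΔ public

  InΔ-subst : ∀ {X Y m m′ z} → X ≡ Y → m ≡ m′ → InΔ X m z → InΔ Y m′ z
  InΔ-subst refl refl z∈Δ = z∈Δ

  InΔ-≗ : ∀ {X m z w} → z ≗ₚ w → InΔ X m z → InΔ X m w
  InΔ-≗ {X} z≗w (inΔ supp 0≤z Σz) =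
    inΔ (λ i i∉X → trans (sym (z≗w i)) (supp i i∉X))
        (λ i → subst (0ℚ ≤_) (z≗w i) (0≤z i))
        (trans (sumOn-cong X (λ {i} _ → sym (z≗w i))) Σz)

  InΔ₀⇒≡0 : ∀ {X z} → InΔ X 0ℚ z → ∀ i → z i ≡ 0ℚ
  InΔ₀⇒≡0 {X} (inΔ supp 0≤z Σz≡0) i with i ∈? X
  ... | yes i∈X = sumOn≡0⇒≡0 X 0≤z Σz≡0 i∈X
  ... | no  i∉X = supp i i∉X

  scaledBasis-≡ : ∀ (i : Fin n) k → scaledBasis i k i ≡ ℕ→ℚ k
  scaledBasis-≡ i k with i Fin.≟ i
  ... | yes _   = refl
  ... | no  i≢i = ⊥-elim (i≢i refl)

  scaledBasis-≢ : ∀ {j i : Fin n} k → j ≢ i → scaledBasis j k i ≡ 0ℚ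
  scaledBasis-≢ {j} {i} k j≢i with j Fin.≟ i
  ... | yes j≡i = ⊥-elim (j≢i j≡i)
  ... | no  _   = refl

  0≤scaledBasis : ∀ (j : Fin n) k i → 0ℚ ≤ scaledBasis j k i
  0≤scaledBasis j k i with j Fin.≟ i
  ... | yes _ = 0≤ℕ→ℚ k
  ... | no  _ = QP.≤-refl

  simplexOn : List (Fin n) → ℕ → SimplexData n
  simplexOn X k = map (λ j → j , k) X

  vertexPoints : List (Fin n) → ℕ → List (Pt n)
  vertexPoints X k = map (λ jk → scaledBasis (proj₁ jk) (proj₂ jk)) (simplexOn X k)

  combination : List ℚ → List (Pt n) → Pt n
  combination ws ps i = sumℚ (zipWith (λ w v → w * v i) ws ps)

  combination∈Δ : ∀ X k ws → Unique X → length ws ≡ length (vertexPoints X k) → All (0ℚ ≤_) ws →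
                  InΔ X (sumℚ ws * ℕ→ℚ k) (combination ws (vertexPoints X k))
  combination∈Δ []      k []       _           _   _            =
    inΔ (λ _ _ → refl) (λ _ → QP.≤-refl) (sym (QP.*-zeroˡ (ℕ→ℚ k)))
  combination∈Δ (x ∷ X) k (w ∷ ws) (x∉X ∷ X!) len (0≤w ∷ 0≤ws) = inΔ supp 0≤c Σc
    where
    K  = ℕ→ℚ k
    c′ = combination ws (vertexPoints X k)
    c′∈Δ = combination∈Δ X k ws X! (ℕP.suc-injective len) 0≤ws
    wex≡0 : ∀ {i} → x ≢ i → w * scaledBasis x k i ≡ 0ℚ
    wex≡0 x≢i = trans (cong (w *_) (scaledBasis-≢ k x≢i)) (QP.*-zeroʳ w)
    x∉X′ : ∀ {i} → i ∈ X → x ≢ i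
    x∉X′ i∈X refl = All.lookup x∉X i∈X refl
    supp : Supported (x ∷ X) (λ i → w * scaledBasis x k i + c′ i)
    supp i i∉ = cong₂ _+_ (wex≡0 (λ { refl → i∉ (here refl) })) (supported c′∈Δ i (λ i∈X → i∉ (there i∈X)))
    0≤c : NonNeg (λ i → w * scaledBasis x k i + c′ i)
    0≤c i = 0≤+ (0≤* 0≤w (0≤scaledBasis x k i)) (nonNeg c′∈Δ i)
    Σc : (w * scaledBasis x k x + c′ x) + sumOn X (λ i → w * scaledBasis x k i + c′ i) ≡ (w + sumℚ ws) * K
    Σc = begin
      (w * scaledBasis x k x + c′ x) + sumOn X (λ i → w * scaledBasis x k i + c′ i)
        ≡⟨ cong₂ _+_ (cong₂ _+_ (cong (w *_) (scaledBasis-≡ x k)) (supported c′∈Δ x (λ x∈X → x∉X′ x∈X refl)))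
                     (sumOn-+ X (λ i → w * scaledBasis x k i) c′) ⟩
      (w * K + 0ℚ) + (sumOn X (λ i → w * scaledBasis x k i) + sumOn X c′)
        ≡⟨ cong (λ s → (w * K + 0ℚ) + s) (cong₂ _+_ (sumOn-zero X (λ i∈X → wex≡0 (x∉X′ i∈X))) (mass c′∈Δ)) ⟩
      (w * K + 0ℚ) + (0ℚ + sumℚ ws * K)
        ≡⟨ solve 3 (λ w s K → (w :* K :+ con 0ℚ) :+ (con 0ℚ :+ s :* K) := (w :+ s) :* K) refl w (sumℚ ws) K ⟩
      (w + sumℚ ws) * K ∎
      where open ≡-Reasoning

  InSimplex⇒InΔ : ∀ {X k z} → Unique X → InSimplex (simplexOn X k) z → InΔ X (ℕ→ℚ k) z
  InSimplex⇒InΔ {X} {k} X! (ws , len , 0≤ws , Σws≡1 , z≡) =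
    InΔ-subst refl (trans (cong (_* ℕ→ℚ k) Σws≡1) (QP.*-identityˡ (ℕ→ℚ k)))
      (InΔ-≗ (λ i → sym (z≡ i)) (combination∈Δ X k ws X! len 0≤ws))

  combination-map : ∀ X k (f : Fin n → ℚ) i →
    combination (map f X) (vertexPoints X k) i ≡ sumOn X (λ j → f j * scaledBasis j k i)
  combination-map []      k f i = refl
  combination-map (x ∷ X) k f i = cong (f x * scaledBasis x k i +_) (combination-map X k f i)

  InΔ⇒InSimplex : ∀ {X k z} → Unique X → k ≢ 0 → InΔ X (ℕ→ℚ k) z → InSimplex (simplexOn X k) z
  InΔ⇒InSimplex {X} {zero}    {z} _  k≢0 _ = ⊥-elim (k≢0 refl)
  InΔ⇒InSimplex {X} {suc k′} {z} X! _  (inΔ supp 0≤z Σz) = ws , len , 0≤ws , Σws≡1 , z≡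
    where
    k = suc k′
    K = ℕ→ℚ k
    instance
      K≢0 : Q.NonZero K
      K≢0 = Q.>-nonZero (0<ℕ→ℚ-suc k′)
    c = 1/ K
    f : Fin n → ℚ
    f j = c * z j
    ws = map f X
    len : length ws ≡ length (vertexPoints X k)
    len = trans (length-map f X) (sym (trans (length-map _ (simplexOn X k)) (length-map _ X)))
    0≤c : 0ℚ ≤ c
    0≤c = QP.<⇒≤ (QP.positive⁻¹ _ {{QP.1/pos⇒pos K {{Q.positive (0<ℕ→ℚ-suc k′)}}}})
    0≤ws : All (0ℚ ≤_) ws
    0≤ws = AllP.map⁺ (All.universal (λ j → 0≤* 0≤c (0≤z j)) X)
    Σws≡1 : sumℚ ws ≡ 1ℚ
    Σws≡1 = trans (sumOn-* X c z) (trans (cong (c *_) Σz) (QP.*-inverseˡ K))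
    z≡ : ∀ i → z i ≡ combination ws (vertexPoints X k) i
    z≡ i with i ∈? X
    ... | yes i∈X = sym (begin
      combination ws (vertexPoints X k) i         ≡⟨ combination-map X k f i ⟩
      sumOn X (λ j → f j * scaledBasis j k i)     ≡⟨ sumOn-single X X! i∈X (λ j j≢i →
                                                        trans (cong (f j *_) (scaledBasis-≢ k j≢i)) (QP.*-zeroʳ (f j))) ⟩
      c * z i * scaledBasis i k i                 ≡⟨ cong (c * z i *_) (scaledBasis-≡ i k) ⟩
      c * z i * K                                 ≡⟨ solve 3 (λ c z K → c :* z :* K := (c :* K) :* z) refl c (z i) K ⟩
      c * K * z i                                 ≡⟨ cong (_* z i) (QP.*-inverseˡ K) ⟩
      1ℚ * z i                                    ≡⟨ QP.*-identityˡ (z i) ⟩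
      z i                                         ∎)
      where open ≡-Reasoning
    ... | no i∉X = trans (supp i i∉X) (sym (trans (combination-map X k f i)
      (sumOn-zero X (λ {j} j∈X → trans (cong (f j *_) (scaledBasis-≢ {j} {i} k (λ { refl → i∉X j∈X }))) (QP.*-zeroʳ (f j))))))

  simplexOn-valid : ∀ {X k} → X ≢ [] → Unique X → k ≢ 0 → ValidSimplex (simplexOn X k)
  simplexOn-valid {X} {k} X≢[] X! k≢0 =
    map-≢[] X X≢[] ,
    subst Unique (sym (trans (sym (map-∘ X)) (map-id X))) X! ,
    AllP.map⁺ (All.universal (λ _ → k≢0) X)

module _ {n : ℕ} where

  InMinkSum-≗ : ∀ (Ss : List (Pt n → Set)) {p q} → p ≗ₚ q → InMinkSum Ss p → InMinkSum Ss q
  InMinkSum-≗ []       p≗q p≡0                    i = trans (sym (p≗q i)) (p≡0 i)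
  InMinkSum-≗ (S ∷ Ss) p≗q (a , b , a∈ , b∈ , p≡) = a , b , a∈ , b∈ , λ i → trans (sym (p≗q i)) (p≡ i)

  InYGP-++⁻ : ∀ (ss ts : List (SimplexData n)) {z} → InYGP (ss ++ ts) z →
    ∃ λ a → ∃ λ b → InYGP ss a × InYGP ts b × (∀ i → z i ≡ a i + b i)
  InYGP-++⁻ []       ts {z} z∈ = (λ _ → 0ℚ) , z , (λ _ → refl) , z∈ , (λ i → sym (QP.+-identityˡ (z i)))
  InYGP-++⁻ (s ∷ ss) ts (q , r , q∈ , r∈ , z≡q+r) with InYGP-++⁻ ss ts r∈
  ... | a , b , a∈ , b∈ , r≡a+b =
    (λ i → q i + a i) , b , (q , a , q∈ , a∈ , λ i → refl) , b∈ ,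
    λ i → trans (z≡q+r i) (trans (cong (q i +_) (r≡a+b i)) (sym (QP.+-assoc (q i) (a i) (b i))))

  InYGP-++⁺ : ∀ (ss ts : List (SimplexData n)) {a b z} → InYGP ss a → InYGP ts b →
    (∀ i → z i ≡ a i + b i) → InYGP (ss ++ ts) z
  InYGP-++⁺ []       ts {a} {b} a≡0 b∈ z≡a+b = InMinkSum-≗ (map InSimplex ts)
    (λ i → trans (sym (QP.+-identityˡ (b i))) (trans (cong (_+ b i) (sym (a≡0 i))) (sym (z≡a+b i)))) b∈
  InYGP-++⁺ (s ∷ ss) ts {a} {b} (q , r , q∈ , r∈ , a≡q+r) b∈ z≡a+b =
    q , (λ i → r i + b i) , q∈ , InYGP-++⁺ ss ts r∈ b∈ (λ i → refl) ,
    λ i → trans (z≡a+b i) (trans (cong (_+ b i) (a≡q+r i)) (QP.+-assoc (q i) (r i) (b i)))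

sumOn-++₃ : ∀ {A : Set} (B P R : List A) z → sumOn (B ++ (P ++ R)) z ≡ sumOn B z + (sumOn P z + sumOn R z)
sumOn-++₃ B P R z = trans (sumOn-++ B (P ++ R) z) (cong (sumOn B z +_) (sumOn-++ P R z))

module _ {n : ℕ} {B P R : List (Fin n)} (B++P++R! : Unique (B ++ (P ++ R))) where

  open DecMembership (Fin._≟_ {n}) using (_∈?_)

  private
    B∉P++R : ∀ {i} → i ∈ B → i ∉ P ++ R
    B∉P++R = Unique-++⇒disjoint B B++P++R!

    P∉R : ∀ {i} → i ∈ P → i ∉ R
    P∉R = Unique-++⇒disjoint P (Unique-++⁻ʳ B B++P++R!)

    B++P∉R : ∀ {i} → i ∈ B ++ P → i ∉ R
    B++P∉R i∈B++P i∈R with ∈-++⁻ B i∈B++P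
    ... | inj₁ i∈B = B∉P++R i∈B (∈-++⁺ʳ P i∈R)
    ... | inj₂ i∈P = P∉R i∈P i∈R

    B++R∉P : ∀ {i} → i ∈ B ++ R → i ∉ P
    B++R∉P i∈B++R i∈P with ∈-++⁻ B i∈B++R
    ... | inj₁ i∈B = B∉P++R i∈B (∈-++⁺ˡ i∈P)
    ... | inj₂ i∈R = P∉R i∈P i∈R

    B++P⊆ : B ++ P ⊆ B ++ (P ++ R)
    B++P⊆ = ++⁺ʳ B (xs⊆xs++ys P R)

    B++R⊆ : B ++ R ⊆ B ++ (P ++ R)
    B++R⊆ = ++⁺ʳ B (xs⊆ys++xs R P)

  InΔ-merge : ∀ {p r a b z} → InΔ (B ++ P) p a → InΔ (B ++ R) r b → (∀ i → z i ≡ a i + b i) →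
    InΔ (B ++ (P ++ R)) (p + r) z × (∀ {i} → i ∈ P → z i ≡ a i) × (∀ {i} → i ∈ R → z i ≡ b i)
  InΔ-merge {p} {r} {a} {b} {z} a∈Δ b∈Δ z≡a+b = inΔ supp 0≤z Σz , z≡a , z≡b
    where
    a≡0 : ∀ {i} → i ∈ R → a i ≡ 0ℚ
    a≡0 i∈R = supported a∈Δ _ (λ i∈B++P → B++P∉R i∈B++P i∈R)
    b≡0 : ∀ {i} → i ∈ P → b i ≡ 0ℚ
    b≡0 i∈P = supported b∈Δ _ (λ i∈B++R → B++R∉P i∈B++R i∈P)
    z≡a : ∀ {i} → i ∈ P → z i ≡ a i
    z≡a {i} i∈P = trans (z≡a+b i) (trans (cong (a i +_) (b≡0 i∈P)) (QP.+-identityʳ (a i)))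
    z≡b : ∀ {i} → i ∈ R → z i ≡ b i
    z≡b {i} i∈R = trans (z≡a+b i) (trans (cong (_+ b i) (a≡0 i∈R)) (QP.+-identityˡ (b i)))
    supp : Supported (B ++ (P ++ R)) z
    supp i i∉ = trans (z≡a+b i)
      (cong₂ _+_ (supported a∈Δ i (λ i∈ → i∉ (B++P⊆ i∈))) (supported b∈Δ i (λ i∈ → i∉ (B++R⊆ i∈))))
    0≤z : NonNeg z
    0≤z i = subst (0ℚ ≤_) (sym (z≡a+b i)) (0≤+ (nonNeg a∈Δ i) (nonNeg b∈Δ i))
    Σa : sumOn (B ++ (P ++ R)) a ≡ p
    Σa = begin
      sumOn (B ++ (P ++ R)) a             ≡⟨ sumOn-++₃ B P R a ⟩
      sumOn B a + (sumOn P a + sumOn R a) ≡⟨ cong (λ s → sumOn B a + (sumOn P a + s)) (sumOn-zero R a≡0) ⟩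
      sumOn B a + (sumOn P a + 0ℚ)        ≡⟨ cong (sumOn B a +_) (QP.+-identityʳ (sumOn P a)) ⟩
      sumOn B a + sumOn P a               ≡⟨ sym (sumOn-++ B P a) ⟩
      sumOn (B ++ P) a                    ≡⟨ mass a∈Δ ⟩
      p                                   ∎
      where open ≡-Reasoning
    Σb : sumOn (B ++ (P ++ R)) b ≡ r
    Σb = begin
      sumOn (B ++ (P ++ R)) b             ≡⟨ sumOn-++₃ B P R b ⟩
      sumOn B b + (sumOn P b + sumOn R b) ≡⟨ cong (λ s → sumOn B b + (s + sumOn R b)) (sumOn-zero P b≡0) ⟩
      sumOn B b + (0ℚ + sumOn R b)        ≡⟨ cong (sumOn B b +_) (QP.+-identityˡ (sumOn R b)) ⟩
      sumOn B b + sumOn R b               ≡⟨ sym (sumOn-++ B R b) ⟩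
      sumOn (B ++ R) b                    ≡⟨ mass b∈Δ ⟩
      r                                   ∎
      where open ≡-Reasoning
    Σz : sumOn (B ++ (P ++ R)) z ≡ p + r
    Σz = trans (sumOn-cong (B ++ (P ++ R)) (λ {i} _ → z≡a+b i))
               (trans (sumOn-+ (B ++ (P ++ R)) a b) (cong₂ _+_ Σa Σb))

  -- the fraction of z i assigned to the first summand
  share : ℚ → Fin n → ℚ
  share θ i with i ∈? P | i ∈? B
  ... | yes _ | _     = 1ℚ
  ... | no  _ | yes _ = θ
  ... | no  _ | no  _ = 0ℚ

  share-P : ∀ θ {i} → i ∈ P → share θ i ≡ 1ℚ
  share-P θ {i} i∈P with i ∈? P
  ... | yes _   = refl
  ... | no  i∉P = contradiction i∈P i∉P

  share-B : ∀ θ {i} → i ∈ B → share θ i ≡ θ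
  share-B θ {i} i∈B with i ∈? P | i ∈? B
  ... | yes i∈P | _       = contradiction (∈-++⁺ˡ i∈P) (B∉P++R i∈B)
  ... | no  _   | yes _   = refl
  ... | no  _   | no  i∉B = contradiction i∈B i∉B

  share-∉ : ∀ θ {i} → i ∉ P → i ∉ B → share θ i ≡ 0ℚ
  share-∉ θ {i} i∉P i∉B with i ∈? P | i ∈? B
  ... | yes i∈P | _       = contradiction i∈P i∉P
  ... | no  _   | yes i∈B = contradiction i∈B i∉B
  ... | no  _   | no  _   = refl

  share-bounds : ∀ {θ} → 0ℚ ≤ θ → θ ≤ 1ℚ → ∀ i → 0ℚ ≤ share θ i × share θ i ≤ 1ℚ
  share-bounds {θ} 0≤θ θ≤1 i with i ∈? P | i ∈? B
  ... | yes _ | _     = QP.nonNegative⁻¹ 1ℚ , QP.≤-refl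
  ... | no  _ | yes _ = 0≤θ , θ≤1
  ... | no  _ | no  _ = QP.≤-refl , QP.nonNegative⁻¹ 1ℚ

  record Split (p r : ℚ) (z : Pt n) : Set where
    field
      a b  : Pt n
      a∈Δ  : InΔ (B ++ P) p a
      b∈Δ  : InΔ (B ++ R) r b
      z≡a+b : ∀ i → z i ≡ a i + b i
      a≡z  : ∀ {i} → i ∈ P → a i ≡ z i
      b≡z  : ∀ {i} → i ∈ R → b i ≡ z i

  InΔ-split : ∀ {p r z} → InΔ (B ++ (P ++ R)) (p + r) z → sumOn P z ≤ p → sumOn R z ≤ r → Split p r z
  InΔ-split {p} {r} {z} (inΔ supp 0≤z Σz) ΣP≤p ΣR≤r = record
    { a = a ; b = b ; a∈Δ = inΔ supp-a 0≤a Σa ; b∈Δ = inΔ supp-b 0≤b Σb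
    ; z≡a+b = z≡a+b ; a≡z = a≡z ; b≡z = b≡z }
    where
    sB = sumOn B z
    sP = sumOn P z
    sR = sumOn R z
    α = p - sP
    β = r - sR
    sB≡α+β : sB ≡ α + β
    sB≡α+β = begin
      sB                        ≡⟨ solve 3 (λ x y w → x := (x :+ (y :+ w)) :- (y :+ w)) refl sB sP sR ⟩
      (sB + (sP + sR)) - (sP + sR) ≡⟨ cong (_- (sP + sR)) (trans (sym (sumOn-++₃ B P R z)) Σz) ⟩
      (p + r) - (sP + sR)       ≡⟨ solve 4 (λ p r y w → (p :+ r) :- (y :+ w) := (p :- y) :+ (r :- w)) refl p r sP sR ⟩
      α + β                     ∎
      where open ≡-Reasoning
    ratio = splitRatio (p≤q⇒0≤q-p ΣP≤p) (p≤q⇒0≤q-p ΣR≤r)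
    θ = proj₁ ratio
    θ[α+β]≡α : θ * (α + β) ≡ α
    θ[α+β]≡α = proj₂ (proj₂ (proj₂ ratio))
    w = share θ
    bounds = share-bounds (proj₁ (proj₂ ratio)) (proj₁ (proj₂ (proj₂ ratio)))
    a b : Pt n
    a i = w i * z i
    b i = (1ℚ - w i) * z i
    z≡a+b : ∀ i → z i ≡ a i + b i
    z≡a+b i = solve 2 (λ w z → z := w :* z :+ (con 1ℚ :- w) :* z) refl (w i) (z i)
    a≡z : ∀ {i} → i ∈ P → a i ≡ z i
    a≡z {i} i∈P = trans (cong (_* z i) (share-P θ i∈P)) (QP.*-identityˡ (z i))
    a≡0 : ∀ {i} → i ∉ P → i ∉ B → a i ≡ 0ℚ
    a≡0 {i} i∉P i∉B = trans (cong (_* z i) (share-∉ θ i∉P i∉B)) (QP.*-zeroˡ (z i))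
    b≡z : ∀ {i} → i ∈ R → b i ≡ z i
    b≡z {i} i∈R = trans (cong (λ s → (1ℚ - s) * z i)
                    (share-∉ θ (λ i∈P → P∉R i∈P i∈R) (λ i∈B → B∉P++R i∈B (∈-++⁺ʳ P i∈R))))
                  (solve 1 (λ z → (con 1ℚ :- con 0ℚ) :* z := z) refl (z i))
    supp-a : Supported (B ++ P) a
    supp-a i i∉ = a≡0 (λ i∈P → i∉ (∈-++⁺ʳ B i∈P)) (λ i∈B → i∉ (∈-++⁺ˡ i∈B))
    supp-b : Supported (B ++ R) b
    supp-b i i∉ = byMembership (i ∈? P)
      where
      byMembership : Dec (i ∈ P) → b i ≡ 0ℚ
      byMembership (yes i∈P) = trans (cong (λ s → (1ℚ - s) * z i) (share-P θ i∈P))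
                                 (solve 1 (λ z → (con 1ℚ :- con 1ℚ) :* z := con 0ℚ) refl (z i))
      byMembership (no i∉P) = trans (cong ((1ℚ - w i) *_) (supp i i∉B++P++R)) (QP.*-zeroʳ (1ℚ - w i))
        where
        i∉B++P++R : i ∉ B ++ (P ++ R)
        i∉B++P++R i∈ with ∈-++⁻ B i∈
        ... | inj₁ i∈B = i∉ (∈-++⁺ˡ i∈B)
        ... | inj₂ i∈P++R with ∈-++⁻ P i∈P++R
        ...   | inj₁ i∈P = i∉P i∈P
        ...   | inj₂ i∈R = i∉ (∈-++⁺ʳ B i∈R)
    0≤a : NonNeg a
    0≤a i = 0≤* (proj₁ (bounds i)) (0≤z i)
    0≤b : NonNeg b
    0≤b i = 0≤* (p≤q⇒0≤q-p (proj₂ (bounds i))) (0≤z i)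
    Σa : sumOn (B ++ P) a ≡ p
    Σa = begin
      sumOn (B ++ P) a                       ≡⟨ sumOn-++ B P a ⟩
      sumOn B a + sumOn P a                  ≡⟨ cong₂ _+_ (sumOn-cong B (λ i∈B → cong (_* z _) (share-B θ i∈B))) (sumOn-cong P a≡z) ⟩
      sumOn B (λ i → θ * z i) + sP           ≡⟨ cong (_+ sP) (trans (sumOn-* B θ z) (cong (θ *_) sB≡α+β)) ⟩
      θ * (α + β) + sP                       ≡⟨ cong (_+ sP) θ[α+β]≡α ⟩
      (p - sP) + sP                          ≡⟨ solve 2 (λ p y → (p :- y) :+ y := p) refl p sP ⟩
      p                                      ∎
      where open ≡-Reasoning
    Σb : sumOn (B ++ R) b ≡ r
    Σb = begin
      sumOn (B ++ R) b                       ≡⟨ sumOn-++ B R b ⟩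
      sumOn B b + sumOn R b                  ≡⟨ cong₂ _+_ (sumOn-cong B (λ i∈B → cong (λ s → (1ℚ - s) * z _) (share-B θ i∈B))) (sumOn-cong R b≡z) ⟩
      sumOn B (λ i → (1ℚ - θ) * z i) + sR    ≡⟨ cong (_+ sR) (trans (sumOn-* B (1ℚ - θ) z) (cong ((1ℚ - θ) *_) sB≡α+β)) ⟩
      (1ℚ - θ) * (α + β) + sR                ≡⟨ cong (_+ sR) (solve 2 (λ t s → (con 1ℚ :- t) :* s := s :- t :* s) refl θ (α + β)) ⟩
      (α + β) - θ * (α + β) + sR             ≡⟨ cong (λ s → (α + β) - s + sR) θ[α+β]≡α ⟩
      (α + (r - sR)) - α + sR                ≡⟨ solve 3 (λ x r y → (x :+ (r :- y)) :- x :+ y := r) refl α r sR ⟩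
      r                                      ∎
      where open ≡-Reasoning

module _ {n : ℕ} where

  Constraints : List (Tree n) → Pt n → Set
  Constraints vs z = All (λ v → sumOn (𝒟 v) z ≤ ℕ→ℚ (length (𝒟 v))) vs

  NonEmptyLabels : List (Tree n) → Set
  NonEmptyLabels vs = All (λ v → label v ≢ []) vs

  mutual
    𝒟-mono : ∀ (t : Tree n) {v} → v ∈ vertices t → 𝒟 v ⊆ 𝒟 t
    𝒟-mono (node l cs) (here refl) i∈ = i∈
    𝒟-mono (node l cs) (there v∈) i∈ = ∈-++⁺ʳ l (𝒟s-mono cs v∈ i∈)

    𝒟s-mono : ∀ (cs : List (Tree n)) {v} → v ∈ verticesₛ cs → 𝒟 v ⊆ 𝒟s cs
    𝒟s-mono (c ∷ cs) v∈ i∈ with ∈-++⁻ (vertices c) v∈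
    ... | inj₁ v∈c  = ∈-++⁺ˡ (𝒟-mono c v∈c i∈)
    ... | inj₂ v∈cs = ∈-++⁺ʳ (𝒟 c) (𝒟s-mono cs v∈cs i∈)

  Constraints-cong : ∀ {vs Y z w} → (∀ {v} → v ∈ vs → 𝒟 v ⊆ Y) → (∀ {i} → i ∈ Y → z i ≡ w i) →
                     Constraints vs z → Constraints vs w
  Constraints-cong 𝒟⊆Y z≡w holds = All.tabulate λ {v} v∈ →
    subst (_≤ ℕ→ℚ (length (𝒟 v))) (sumOn-cong (𝒟 v) (λ i∈ → z≡w (𝒟⊆Y v∈ i∈))) (All.lookup holds v∈)

  sumOn-𝒟-≤ : ∀ (t : Tree n) {z} → Constraints (vertices t) z → sumOn (𝒟 t) z ≤ ℕ→ℚ (length (𝒟 t))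
  sumOn-𝒟-≤ (node l cs) (root ∷ _) = root

  sumOn-𝒟s-≤ : ∀ (cs : List (Tree n)) {z} → Constraints (verticesₛ cs) z → sumOn (𝒟s cs) z ≤ ℕ→ℚ (length (𝒟s cs))
  sumOn-𝒟s-≤ []       _    = QP.≤-refl
  sumOn-𝒟s-≤ (c ∷ cs) {z} holds =
    subst₂ _≤_ (sym (sumOn-++ (𝒟 c) (𝒟s cs) z)) (sym (ℕ→ℚ-length-++ (𝒟 c) (𝒟s cs)))
      (QP.+-mono-≤ (sumOn-𝒟-≤ c (AllP.++⁻ˡ (vertices c) holds)) (sumOn-𝒟s-≤ cs (AllP.++⁻ʳ (vertices c) holds)))

  sumOn-suffix-≤ : ∀ (B : List (Fin n)) {Y m z} → InΔ (B ++ Y) m z → sumOn Y z ≤ m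
  sumOn-suffix-≤ B {Y} {m} {z} z∈Δ =
    subst (sumOn Y z ≤_) (trans (sym (sumOn-++ B Y z)) (mass z∈Δ)) (q≤p+q (0≤sumOn B (nonNeg z∈Δ)))

  -- Vertex v contributes |label v| · Δ on B ++ (labels on the path from the root to v).
  mutual
    simplices : List (Fin n) → Tree n → List (SimplexData n)
    simplices B (node l cs) = simplexOn (B ++ l) (length l) ∷ simplicesₛ (B ++ l) cs

    simplicesₛ : List (Fin n) → List (Tree n) → List (SimplexData n)
    simplicesₛ B []       = []
    simplicesₛ B (c ∷ cs) = simplices B c ++ simplicesₛ B cs

  simplices≢[] : ∀ B (t : Tree n) → simplices B t ≢ []
  simplices≢[] B (node l cs) ()

  mutual
    simplices-valid : ∀ B (t : Tree n) → Unique (B ++ 𝒟 t) → NonEmptyLabels (vertices t) → All ValidSimplex (simplices B t)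
    simplices-valid B (node l cs) B++𝒟! (l≢[] ∷ ne) =
      simplexOn-valid (λ B++l≡[] → l≢[] (++-conicalʳ B l B++l≡[])) (Unique-++⁻ˡ (B ++ l) B++l++𝒟!) (length≢0 l l≢[]) ∷
      simplicesₛ-valid (B ++ l) cs B++l++𝒟! ne
      where
      B++l++𝒟! = subst Unique (sym (++-assoc B l (𝒟s cs))) B++𝒟!

    simplicesₛ-valid : ∀ B (cs : List (Tree n)) → Unique (B ++ 𝒟s cs) → NonEmptyLabels (verticesₛ cs) → All ValidSimplex (simplicesₛ B cs)
    simplicesₛ-valid B []       _     _  = []
    simplicesₛ-valid B (c ∷ cs) B++𝒟! ne =
      AllP.++⁺ (simplices-valid B c (proj₁ branches) (AllP.++⁻ˡ (vertices c) ne))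
               (simplicesₛ-valid B cs (proj₂ branches) (AllP.++⁻ʳ (vertices c) ne))
      where
      branches = Unique-++-branches B (𝒟 c) (𝒟s cs) B++𝒟!

  mutual
    simplices⇒InΔ : ∀ B t {z} → Unique (B ++ 𝒟 t) → InYGP (simplices B t) z →
      InΔ (B ++ 𝒟 t) (ℕ→ℚ (length (𝒟 t))) z × Constraints (vertices t) z
    simplices⇒InΔ B (node l cs) B++𝒟! (a , b , a∈ , b∈ , z≡a+b) =
      z∈Δ , sumOn-suffix-≤ B {Y = l ++ 𝒟s cs} z∈Δ ∷ Constraints-cong (𝒟s-mono cs) (λ i∈ → sym (z≡b i∈)) (proj₂ b-ok)
      where
      X = B ++ l
      X++𝒟! = subst Unique (sym (++-assoc B l (𝒟s cs))) B++𝒟!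
      a∈Δ : InΔ (X ++ []) (ℕ→ℚ (length l)) a
      a∈Δ = InΔ-subst (sym (++-identityʳ X)) refl (InSimplex⇒InΔ (Unique-++⁻ˡ X X++𝒟!) a∈)
      b-ok = simplicesₛ⇒InΔ X cs X++𝒟! b∈
      merged = InΔ-merge {B = X} {P = []} {R = 𝒟s cs} X++𝒟! a∈Δ (proj₁ b-ok) z≡a+b
      z≡b = proj₂ (proj₂ merged)
      z∈Δ = InΔ-subst (++-assoc B l (𝒟s cs)) (sym (ℕ→ℚ-length-++ l (𝒟s cs))) (proj₁ merged)

    simplicesₛ⇒InΔ : ∀ B cs {z} → Unique (B ++ 𝒟s cs) → InYGP (simplicesₛ B cs) z →
      InΔ (B ++ 𝒟s cs) (ℕ→ℚ (length (𝒟s cs))) z × Constraints (verticesₛ cs) z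
    simplicesₛ⇒InΔ B [] _ z≡0 =
      inΔ (λ i _ → z≡0 i) (λ i → subst (0ℚ ≤_) (sym (z≡0 i)) QP.≤-refl) (sumOn-zero (B ++ []) (λ {i} _ → z≡0 i)) , []
    simplicesₛ⇒InΔ B (c ∷ cs) B++𝒟! z∈ with InYGP-++⁻ (simplices B c) (simplicesₛ B cs) z∈
    ... | a , b , a∈ , b∈ , z≡a+b =
      InΔ-subst refl (sym (ℕ→ℚ-length-++ (𝒟 c) (𝒟s cs))) (proj₁ merged) ,
      AllP.++⁺ (Constraints-cong (𝒟-mono c) (λ i∈ → sym (proj₁ (proj₂ merged) i∈)) (proj₂ a-ok))
               (Constraints-cong (𝒟s-mono cs) (λ i∈ → sym (proj₂ (proj₂ merged) i∈)) (proj₂ b-ok))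
      where
      branches = Unique-++-branches B (𝒟 c) (𝒟s cs) B++𝒟!
      a-ok = simplices⇒InΔ B c (proj₁ branches) a∈
      b-ok = simplicesₛ⇒InΔ B cs (proj₂ branches) b∈
      merged = InΔ-merge {B = B} {P = 𝒟 c} {R = 𝒟s cs} B++𝒟! (proj₁ a-ok) (proj₁ b-ok) z≡a+b

  mutual
    InΔ⇒simplices : ∀ B t {z} → Unique (B ++ 𝒟 t) → NonEmptyLabels (vertices t) →
      InΔ (B ++ 𝒟 t) (ℕ→ℚ (length (𝒟 t))) z → Constraints (vertices t) z → InYGP (simplices B t) z
    InΔ⇒simplices B (node l cs) B++𝒟! (l≢[] ∷ ne) z∈Δ (_ ∷ holds) =
      a , b ,
      InΔ⇒InSimplex (Unique-++⁻ˡ X X++𝒟!) (length≢0 l l≢[]) (InΔ-subst (++-identityʳ X) refl a∈Δ) ,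
      InΔ⇒simplicesₛ X cs X++𝒟! ne b∈Δ (Constraints-cong (𝒟s-mono cs) (λ i∈ → sym (b≡z i∈)) holds) ,
      z≡a+b
      where
      X = B ++ l
      X++𝒟! = subst Unique (sym (++-assoc B l (𝒟s cs))) B++𝒟!
      open Split (InΔ-split {B = X} {P = []} {R = 𝒟s cs} X++𝒟!
        (InΔ-subst (sym (++-assoc B l (𝒟s cs))) (ℕ→ℚ-length-++ l (𝒟s cs)) z∈Δ)
        (0≤ℕ→ℚ (length l)) (sumOn-𝒟s-≤ cs holds))

    InΔ⇒simplicesₛ : ∀ B cs {z} → Unique (B ++ 𝒟s cs) → NonEmptyLabels (verticesₛ cs) →
      InΔ (B ++ 𝒟s cs) (ℕ→ℚ (length (𝒟s cs))) z → Constraints (verticesₛ cs) z → InYGP (simplicesₛ B cs) z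
    InΔ⇒simplicesₛ B []       _     _  z∈Δ _     = InΔ₀⇒≡0 z∈Δ
    InΔ⇒simplicesₛ B (c ∷ cs) B++𝒟! ne z∈Δ holds =
      InYGP-++⁺ (simplices B c) (simplicesₛ B cs)
        (InΔ⇒simplices B c (proj₁ branches) (AllP.++⁻ˡ (vertices c) ne) a∈Δ
          (Constraints-cong (𝒟-mono c) (λ i∈ → sym (a≡z i∈)) holds-c))
        (InΔ⇒simplicesₛ B cs (proj₂ branches) (AllP.++⁻ʳ (vertices c) ne) b∈Δ
          (Constraints-cong (𝒟s-mono cs) (λ i∈ → sym (b≡z i∈)) holds-cs))
        z≡a+b
      where
      branches = Unique-++-branches B (𝒟 c) (𝒟s cs) B++𝒟!
      holds-c  = AllP.++⁻ˡ (vertices c) holds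
      holds-cs = AllP.++⁻ʳ (vertices c) holds
      open Split (InΔ-split {B = B} {P = 𝒟 c} {R = 𝒟s cs} B++𝒟! (InΔ-subst refl (ℕ→ℚ-length-++ (𝒟 c) (𝒟s cs)) z∈Δ)
        (sumOn-𝒟-≤ c holds-c) (sumOn-𝒟s-≤ cs holds-cs))

mutual
  relabel : ∀ {m n} → (Fin m → Fin n) → Tree m → Tree n
  relabel f (node l cs) = node (map f l) (relabelₛ f cs)

  relabelₛ : ∀ {m n} → (Fin m → Fin n) → List (Tree m) → List (Tree n)
  relabelₛ f []       = []
  relabelₛ f (c ∷ cs) = relabel f c ∷ relabelₛ f cs

module _ {m n : ℕ} (f : Fin m → Fin n) where

  mutual
    𝒟-relabel : ∀ t → 𝒟 (relabel f t) ≡ map f (𝒟 t)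
    𝒟-relabel (node l cs) = trans (cong (map f l ++_) (𝒟s-relabel cs)) (sym (map-++ f l (𝒟s cs)))

    𝒟s-relabel : ∀ cs → 𝒟s (relabelₛ f cs) ≡ map f (𝒟s cs)
    𝒟s-relabel []       = refl
    𝒟s-relabel (c ∷ cs) = trans (cong₂ _++_ (𝒟-relabel c) (𝒟s-relabel cs)) (sym (map-++ f (𝒟 c) (𝒟s cs)))

  mutual
    vertices-relabel : ∀ t → vertices (relabel f t) ≡ map (relabel f) (vertices t)
    vertices-relabel (node l cs) = cong (node (map f l) (relabelₛ f cs) ∷_) (verticesₛ-relabel cs)

    verticesₛ-relabel : ∀ cs → verticesₛ (relabelₛ f cs) ≡ map (relabel f) (verticesₛ cs)
    verticesₛ-relabel []       = refl
    verticesₛ-relabel (c ∷ cs) = trans (cong₂ _++_ (vertices-relabel c) (verticesₛ-relabel cs))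
                                       (sym (map-++ (relabel f) (vertices c) (verticesₛ cs)))

  constraint-relabel : ∀ v z →
    (sumOn (𝒟 (relabel f v)) z ≤ ℕ→ℚ (length (𝒟 (relabel f v)))) ≡ (sumOn (𝒟 v) (λ i → z (f i)) ≤ ℕ→ℚ (length (𝒟 v)))
  constraint-relabel v z = cong₂ (λ s k → s ≤ ℕ→ℚ k)
    (trans (cong (λ Y → sumOn Y z) (𝒟-relabel v)) (sumOn-map (𝒟 v) f z))
    (trans (cong length (𝒟-relabel v)) (length-map f (𝒟 v)))

  Constraints-relabel⁺ : ∀ t {z} → Constraints (vertices t) (λ i → z (f i)) → Constraints (vertices (relabel f t)) z
  Constraints-relabel⁺ t {z} holds = subst (λ vs → Constraints vs z) (sym (vertices-relabel t))
    (AllP.map⁺ (All.map (λ {v} → subst (λ A → A) (sym (constraint-relabel v z))) holds))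

  Constraints-relabel⁻ : ∀ t {z} → Constraints (vertices (relabel f t)) z → Constraints (vertices t) (λ i → z (f i))
  Constraints-relabel⁻ t {z} holds = All.map (λ {v} → subst (λ A → A) (constraint-relabel v z))
    (AllP.map⁻ (subst (λ vs → Constraints vs z) (vertices-relabel t) holds))

  NonEmptyLabels-relabel : ∀ t → NonEmptyLabels (vertices t) → NonEmptyLabels (vertices (relabel f t))
  NonEmptyLabels-relabel t ne = subst NonEmptyLabels (sym (vertices-relabel t))
    (AllP.map⁺ (All.map (λ {v} → map-label≢[] v) ne))
    where
    map-label≢[] : ∀ v → label v ≢ [] → label (relabel f v) ≢ []
    map-label≢[] (node l _) = map-≢[] l

sumFin-IsInt : ∀ n {y : Pt n} → IsLattice y → IsInt (sumFin n y)
sumFin-IsInt zero    _     = ℤ.+ 0 , refl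
sumFin-IsInt (suc n) y∈ℤⁿ = IsInt-+ (y∈ℤⁿ zero) (sumFin-IsInt n (λ i → y∈ℤⁿ (suc i)))

projection : ∀ d → Affine (suc d) d
projection d = affine (λ i → scaledBasis (suc i) 1) (λ _ → 0ℚ)

apply-projection : ∀ {d} z i → apply (projection d) z i ≡ z (suc i)
apply-projection {d} z i = begin
  sumFin (suc d) eᵢz + 0ℚ                    ≡⟨ QP.+-identityʳ _ ⟩
  sumFin (suc d) eᵢz                         ≡⟨ sym (sumOn-tabulate (suc d) (λ j → j) eᵢz) ⟩
  sumOn (allFin (suc d)) eᵢz                 ≡⟨ sumOn-single (allFin (suc d)) (UniqueP.allFin⁺ (suc d)) (∈-allFin (suc i))
                                                  (λ j j≢ → trans (cong (_* z j) (scaledBasis-≢ 1 (λ e → j≢ (sym e)))) (QP.*-zeroˡ (z j))) ⟩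
  scaledBasis (suc i) 1 (suc i) * z (suc i)  ≡⟨ cong (_* z (suc i)) (scaledBasis-≡ (suc i) 1) ⟩
  ℕ→ℚ 1 * z (suc i)                          ≡⟨ QP.*-identityˡ (z (suc i)) ⟩
  z (suc i)                                  ∎
  where
  open ≡-Reasoning
  eᵢz : Fin (suc d) → ℚ
  eᵢz j = scaledBasis (suc i) 1 j * z j

withSlack : ∀ d → Pt d → Pt (suc d)
withSlack d y zero    = ℕ→ℚ d - sumFin d y
withSlack d y (suc i) = y i

withSlack-hyperplane : ∀ d y → InHyp (ℤ.+ d) (withSlack d y)
withSlack-hyperplane d y = solve 2 (λ D s → (D :- s) :+ s := D) refl (ℕ→ℚ d) (sumFin d y)

projection-unimodular : ∀ d → IsUnimodularOn (ℤ.+ d) (projection d)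
projection-unimodular d = injective , surjective , preserves-lattice , reflects-lattice
  where
  injective : ∀ z z′ → InHyp (ℤ.+ d) z → InHyp (ℤ.+ d) z′ →
              apply (projection d) z ≗ₚ apply (projection d) z′ → z ≗ₚ z′
  injective z z′ Σz Σz′ fz≗fz′ zero = begin
    z zero              ≡⟨ solve 2 (λ x s → x := (x :+ s) :- s) refl (z zero) s ⟩
    (z zero + s) - s    ≡⟨ cong₂ _-_ (trans Σz (sym Σz′)) s≡s′ ⟩
    (z′ zero + s′) - s′ ≡⟨ solve 2 (λ x s → (x :+ s) :- s := x) refl (z′ zero) s′ ⟩
    z′ zero             ∎
    where
    open ≡-Reasoning
    s  = sumFin d (λ i → z (suc i))
    s′ = sumFin d (λ i → z′ (suc i))
    s≡s′ : s ≡ s′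
    s≡s′ = sumFin-cong d (λ i → trans (sym (apply-projection z i)) (trans (fz≗fz′ i) (apply-projection z′ i)))
  injective z z′ _ _ fz≗fz′ (suc i) = trans (sym (apply-projection z i)) (trans (fz≗fz′ i) (apply-projection z′ i))

  surjective : ∀ y → ∃ λ z → InHyp (ℤ.+ d) z × apply (projection d) z ≗ₚ y
  surjective y = withSlack d y , withSlack-hyperplane d y , apply-projection (withSlack d y)

  preserves-lattice : ∀ z → InHyp (ℤ.+ d) z → IsLattice z → IsLattice (apply (projection d) z)
  preserves-lattice z _ z∈ℤ i = subst IsInt (sym (apply-projection z i)) (z∈ℤ (suc i))

  reflects-lattice : ∀ y → IsLattice y → ∃ λ z → InHyp (ℤ.+ d) z × IsLattice z × apply (projection d) z ≗ₚ y
  reflects-lattice y y∈ℤ = withSlack d y , withSlack-hyperplane d y , slack∈ℤ , apply-projection (withSlack d y)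
    where
    slack∈ℤ : IsLattice (withSlack d y)
    slack∈ℤ zero    = IsInt-- (ℤ.+ d , refl) (sumFin-IsInt d y∈ℤ)
    slack∈ℤ (suc i) = y∈ℤ i

module ArborPolytope {d : ℕ} (t : Tree d) (arbor : IsArbor t) where

  private
    T : Tree (suc d)
    T = relabel suc t

    𝒟t↭allFin : 𝒟 t ↭ allFin d
    𝒟t↭allFin = proj₂ arbor

    coordinates↭allFin : zero ∷ 𝒟 T ↭ allFin (suc d)
    coordinates↭allFin = ↭-prep zero (↭-trans (↭-reflexive (𝒟-relabel suc t))
      (↭-trans (↭P.map⁺ suc 𝒟t↭allFin) (↭-reflexive (map-tabulate (λ i → i) suc))))

    coordinates! : Unique (zero ∷ 𝒟 T)
    coordinates! = Unique-↭-allFin coordinates↭allFin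

    length-𝒟T : length (𝒟 T) ≡ d
    length-𝒟T = ℕP.suc-injective (length-↭-allFin coordinates↭allFin)

  Q′ : List (SimplexData (suc d))
  Q′ = simplices (zero ∷ []) T

  Q′-valid : ValidYGP Q′
  Q′-valid = simplices≢[] (zero ∷ []) T , simplices-valid (zero ∷ []) T coordinates! (NonEmptyLabels-relabel suc t (proj₁ arbor))

  Q′⊆hyperplane : ∀ z → InYGP Q′ z → InHyp (ℤ.+ d) z
  Q′⊆hyperplane z z∈Q′ = begin
    sumFin (suc d) z             ≡⟨ sym (sumOn-↭-allFin coordinates↭allFin z) ⟩
    sumOn (zero ∷ 𝒟 T) z         ≡⟨ mass (proj₁ (simplices⇒InΔ (zero ∷ []) T coordinates! z∈Q′)) ⟩
    ℕ→ℚ (length (𝒟 T))          ≡⟨ cong ℕ→ℚ length-𝒟T ⟩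
    ℕ→ℚ d                        ∎
    where open ≡-Reasoning

  Q′⇒Q : ∀ z → InYGP Q′ z → InQ t (apply (projection d) z)
  Q′⇒Q z z∈Q′ =
    (λ i → subst (0ℚ ≤_) (sym (apply-projection z i)) (nonNeg (proj₁ lifted) (suc i))) ,
    Constraints-cong (𝒟-mono t) (λ {i} _ → sym (apply-projection z i)) (Constraints-relabel⁻ suc t (proj₂ lifted))
    where
    lifted = simplices⇒InΔ (zero ∷ []) T coordinates! z∈Q′

  Q⇒Q′ : ∀ x → InQ t x → ∃ λ z → InYGP Q′ z × apply (projection d) z ≗ₚ x
  Q⇒Q′ x (0≤x , holds) =
    z , InΔ⇒simplices (zero ∷ []) T coordinates! (NonEmptyLabels-relabel suc t (proj₁ arbor)) z∈Δ
          (Constraints-relabel⁺ suc t holds) ,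
    apply-projection z
    where
    z = withSlack d x
    0≤z : NonNeg z
    0≤z zero    = p≤q⇒0≤q-p (subst₂ _≤_ (sumOn-↭-allFin 𝒟t↭allFin x) (cong ℕ→ℚ (length-↭-allFin 𝒟t↭allFin))
                                          (sumOn-𝒟-≤ t holds))
    0≤z (suc i) = 0≤x i
    z∈Δ : InΔ (zero ∷ 𝒟 T) (ℕ→ℚ (length (𝒟 T))) z
    z∈Δ = inΔ (λ i i∉ → contradiction (∈-↭-allFin coordinates↭allFin i) i∉) 0≤z
      (trans (sumOn-↭-allFin coordinates↭allFin z) (trans (withSlack-hyperplane d x) (cong ℕ→ℚ (sym length-𝒟T))))

lemma1p8 : (d : ℕ) (t : Tree d) → IsArbor t →
    ∃ λ (ss : List (SimplexData (Data.Nat.suc d))) → ValidYGP ss ×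
    ∃ λ (c : ℤ) → (∀ z → InYGP ss z → InHyp c z) ×
    ∃ λ (f : Affine (Data.Nat.suc d) d) → IsUnimodularOn c f
    × (∀ z → InYGP ss z → InQ t (apply f z))
    × (∀ x → InQ t x → ∃ λ z → InYGP ss z × apply f z ≗ₚ x)
lemma1p8 d t arbor =
  Q′ , Q′-valid , ℤ.+ d , Q′⊆hyperplane , projection d , projection-unimodular d , Q′⇒Q , Q⇒Q′
  where open ArborPolytope t arbor
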